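{- Let $w$ be a Lyndon word with respect to $\prec$. For any interval $[i..j]$ with $1\le i\le j\le |w|$ such that $w[i..j]$ is a Lyndon word, the node $\alpha=\mathit{lca}([i..j])=[i_\alpha..j_\alpha]$ of $\mathit{LTree}(w)$ satisfies $i_\alpha=i\le j\le j_\alpha$.
   Context: $\Sigma$ is a finite alphabet with a total order, and $\prec$ the induced lexicographic order on strings (a proper prefix is smaller). Strings are indexed from 1. A nonempty string $u$ is a Lyndon word if $u\prec v$ for every nonempty proper suffix $v$ of $u$. The standard factorization of a Lyndon word $u$ with $|u|\ge2$ is the pair $(x,y)$ with $u=xy$ where $y$ is the lexicographically smallest nonempty proper suffix of $u$ (both $x,y$ are then Lyndon words). The Lyndon tree $\mathit{LTree}(w)$ is the ordered full binary tree defined recursively: if $|w|=1$ it is a single node labeled $w$; otherwise its root is labeled $w$ and has left child $\mathit{LTree}(x)$ and right child $\mathit{LTree}(y)$ where $(x,y)$ is the standard factorization of $w$. Each node is identified with the interval $[a..b]$ of positions of $w$ it spans (leaves are $[k..k]$). $\mathit{lca}([i..j])$ is the lowest common ancestor of the leaves $[i..i]$ and $[j..j]$. -}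

module Defs where

open import Data.Nat using (ℕ; zero; suc; _+_; _∸_; _≤_; _<_)
open import Data.Fin as Fin using (Fin)
open import Data.List using (List; []; _∷_; length; take; drop)
open import Data.Product using (_×_)
open import Data.Sum using (_⊎_)
open import Relation.Binary.PropositionalEquality using (_≡_)

-- Alphabet: a finite totally ordered alphabet of size σ is (up to
-- order-isomorphism) Fin σ with its usual order.
Word : ℕ → Set
Word σ = List (Fin σ)

data _≺_ {σ : ℕ} : Word σ → Word σ → Set where
  nil≺  : ∀ {b v} → [] ≺ (b ∷ v)
  head≺ : ∀ {a b u v} → a Fin.< b → (a ∷ u) ≺ (b ∷ v)
  tail≺ : ∀ {a u v} → u ≺ v → (a ∷ u) ≺ (a ∷ v)

_⪯_ : ∀ {σ} → Word σ → Word σ → Set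
u ⪯ v = u ≺ v ⊎ u ≡ v

IsLyndon : ∀ {σ} → Word σ → Set
IsLyndon u = (1 ≤ length u) × (∀ k → 1 ≤ k → k < length u → u ≺ drop k u)

-- w[i..j] with 1-based positions.
factor : ∀ {σ} → Word σ → ℕ → ℕ → Word σ
factor w i j = take (suc j ∸ i) (drop (i ∸ 1) w)

-- Standard factorization of the node [a..b]: split after position c
-- (children [a..c] and [c+1..b]), where w[c+1..b] is the lexicographically
-- smallest nonempty proper suffix of w[a..b].
IsSplit : ∀ {σ} → Word σ → ℕ → ℕ → ℕ → Set
IsSplit w a b c =
  (a ≤ c) × (c < b) ×
  (∀ k → a < k → k ≤ b → factor w (suc c) b ⪯ factor w k b)

-- SubNode w a b x y : [x..y] is a node of the subtree of LTree(w) rooted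
-- at the node [a..b] (i.e. [x..y] is a descendant-or-self of [a..b]).
data SubNode {σ : ℕ} (w : Word σ) : ℕ → ℕ → ℕ → ℕ → Set where
  here  : ∀ {a b} → SubNode w a b a b
  left  : ∀ {a b c x y} → IsSplit w a b c →
          SubNode w a c x y → SubNode w a b x y
  right : ∀ {a b c x y} → IsSplit w a b c →
          SubNode w (suc c) b x y → SubNode w a b x y

IsNode : ∀ {σ} → Word σ → ℕ → ℕ → Set
IsNode w x y = SubNode w 1 (length w) x y

CommonAnc : ∀ {σ} → Word σ → ℕ → ℕ → ℕ → ℕ → Set
CommonAnc w i j a b = IsNode w a b × SubNode w a b i i × SubNode w a b j j

IsLCA : ∀ {σ} → Word σ → ℕ → ℕ → ℕ → ℕ → Set
IsLCA w i j a b =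
  CommonAnc w i j a b × (∀ a' b' → CommonAnc w i j a' b' → SubNode w a' b' a b)

-- Follow the leaves i and j down from their lca [a..b].  Minimality of the
-- lca forces them apart at [a..b] itself (or [a..b] is a leaf): i lies in the
-- left child [a..c] and j in the right child [c+1..b].  If a < i, then the
-- Lyndon word w[i..j] straddles c, so w[i..j] ≺ w[c+1..j]; the right-hand side
-- is the shorter word, so the comparison is decided by a mismatch and survives
-- extending both words to b: w[i..b] ≺ w[c+1..b].  This contradicts the choice
-- of w[c+1..b] as the smallest proper suffix of w[a..b].
module Submission where

open import Defs
open import Data.Nat using (ℕ; zero; suc; _+_; _∸_; _⊓_; _≤_; _<_; z≤n; s≤s)
open import Data.Nat.Properties
open import Data.List using ([]; _∷_; length; take; drop)
open import Data.List.Properties using (length-take; length-drop; take-drop; drop-drop)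
open import Data.Product using (_×_; _,_; proj₁; proj₂)
open import Data.Sum using (inj₁; inj₂)
open import Data.Empty using (⊥-elim)
open import Relation.Nullary using (¬_)
open import Relation.Binary.PropositionalEquality

module _ {σ : ℕ} where

  ≺-irrefl : {u : Word σ} → ¬ u ≺ u
  ≺-irrefl (head≺ a<a) = <-irrefl refl a<a
  ≺-irrefl (tail≺ u≺u) = ≺-irrefl u≺u

  ≺-asym : {u v : Word σ} → u ≺ v → ¬ v ≺ u
  ≺-asym (head≺ a<b) (head≺ b<a) = <-asym a<b b<a
  ≺-asym (head≺ a<a) (tail≺ _)   = <-irrefl refl a<a
  ≺-asym (tail≺ _)   (head≺ a<a) = <-irrefl refl a<a
  ≺-asym (tail≺ u≺v) (tail≺ v≺u) = ≺-asym u≺v v≺u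

  ≺⇒⋡ : {u v : Word σ} → u ≺ v → ¬ v ⪯ u
  ≺⇒⋡ u≺v (inj₁ v≺u)  = ≺-asym u≺v v≺u
  ≺⇒⋡ u≺v (inj₂ refl) = ≺-irrefl u≺v

  ⪯-antisym : {u v : Word σ} → u ⪯ v → v ⪯ u → u ≡ v
  ⪯-antisym (inj₂ u≡v) _   = u≡v
  ⪯-antisym (inj₁ u≺v) v⪯u = ⊥-elim (≺⇒⋡ u≺v v⪯u)

  -- Since m ≤ n, the word take n s is not a proper prefix of take m t unless s
  -- is exhausted, so the comparison is decided within the first m letters.
  ≺-take-extend : ∀ {m n M N} (s t : Word σ) → m ≤ n → m ≤ M → n ≤ N →
                  take n s ≺ take m t → take N s ≺ take M t
  ≺-take-extend {zero} s t _ _ _ ()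
  ≺-take-extend {suc _} [] (_ ∷ _) (s≤s _) (s≤s _) (s≤s _) _ = nil≺
  ≺-take-extend {suc _} (_ ∷ _) (_ ∷ _) (s≤s _) (s≤s _) (s≤s _) (head≺ a<b) =
    head≺ a<b
  ≺-take-extend {suc _} (_ ∷ s) (_ ∷ t) (s≤s m≤n) (s≤s m≤M) (s≤s n≤N) (tail≺ p) =
    tail≺ (≺-take-extend s t m≤n m≤M n≤N p)

  length-factor : ∀ (w : Word σ) {i j} → 1 ≤ i → j ≤ length w →
                  length (factor w i j) ≡ suc j ∸ i
  length-factor w {suc x} {j} (s≤s z≤n) j≤∣w∣ = begin
    length (take (j ∸ x) (drop x w))  ≡⟨ length-take (j ∸ x) (drop x w) ⟩
    (j ∸ x) ⊓ length (drop x w)       ≡⟨ m≤n⇒m⊓n≡m (subst (j ∸ x ≤_) (sym (length-drop x w))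
                                                     (∸-monoˡ-≤ x j≤∣w∣)) ⟩
    j ∸ x                             ∎
    where open ≡-Reasoning

  drop-factor : ∀ (w : Word σ) {i k j} → 1 ≤ i → i ≤ k → k ≤ suc j →
                drop (k ∸ i) (factor w i j) ≡ factor w k j
  drop-factor w {suc x} {suc y} {j} (s≤s z≤n) (s≤s x≤y) (s≤s y≤j) = begin
    drop (y ∸ x) (take (j ∸ x) (drop x w))
      ≡⟨ cong (λ n → drop (y ∸ x) (take n (drop x w))) j∸x≡[y∸x]+[j∸y] ⟩
    drop (y ∸ x) (take (y ∸ x + (j ∸ y)) (drop x w))
      ≡⟨ take-drop (j ∸ y) (y ∸ x) (drop x w) ⟨
    take (j ∸ y) (drop (y ∸ x) (drop x w))
      ≡⟨ cong (take (j ∸ y)) (drop-drop x (y ∸ x) w) ⟩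
    take (j ∸ y) (drop (x + (y ∸ x)) w)
      ≡⟨ cong (λ n → take (j ∸ y) (drop n w)) (m+[n∸m]≡n x≤y) ⟩
    take (j ∸ y) (drop y w)
      ∎
    where
    open ≡-Reasoning
    j∸x≡[y∸x]+[j∸y] : j ∸ x ≡ y ∸ x + (j ∸ y)
    j∸x≡[y∸x]+[j∸y] = trans (cong (_∸ x) (sym (m+[n∸m]≡n y≤j))) (+-∸-comm (j ∸ y) x≤y)

  factor-≺-extend : ∀ (w : Word σ) {i k j b} → i ≤ k → j ≤ b →
                    factor w i j ≺ factor w k j → factor w i b ≺ factor w k b
  factor-≺-extend w {i} {k} {j} i≤k j≤b =
    ≺-take-extend (drop (i ∸ 1) w) (drop (k ∸ 1) w)
      (∸-monoʳ-≤ (suc j) i≤k) (∸-monoˡ-≤ k (s≤s j≤b)) (∸-monoˡ-≤ i (s≤s j≤b))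

  lyndon-factor-≺-suffix : ∀ (w : Word σ) {i k j} → 1 ≤ i → i < k → k ≤ j →
                           j ≤ length w → IsLyndon (factor w i j) →
                           factor w i j ≺ factor w k j
  lyndon-factor-≺-suffix w {i} {k} {j} 1≤i i<k k≤j j≤∣w∣ (_ , ≺-suffixes) =
    subst (factor w i j ≺_) (drop-factor w 1≤i (<⇒≤ i<k) (m≤n⇒m≤1+n k≤j))
      (≺-suffixes (k ∸ i) (m<n⇒0<n∸m i<k)
        (subst (k ∸ i <_) (sym (length-factor w 1≤i j≤∣w∣)) (∸-monoˡ-< (s≤s k≤j) (<⇒≤ i<k))))

  SubNode-bounds : ∀ {w : Word σ} {a b x y} → SubNode w a b x y → a ≤ x × y ≤ b
  SubNode-bounds here = ≤-refl , ≤-refl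
  SubNode-bounds (left (_ , c<b , _) sub) with SubNode-bounds sub
  ... | a≤x , y≤c = a≤x , ≤-trans y≤c (<⇒≤ c<b)
  SubNode-bounds (right (a≤c , _ , _) sub) with SubNode-bounds sub
  ... | c<x , y≤b = ≤-trans a≤c (<⇒≤ c<x) , y≤b

  SubNode-trans : ∀ {w : Word σ} {a b p q x y} →
                  SubNode w a b p q → SubNode w p q x y → SubNode w a b x y
  SubNode-trans here        sub = sub
  SubNode-trans (left s p)  sub = left s (SubNode-trans p sub)
  SubNode-trans (right s p) sub = right s (SubNode-trans p sub)

  ¬SubNode-left-child : ∀ {w : Word σ} {a b c} → IsSplit w a b c → ¬ SubNode w a c a b
  ¬SubNode-left-child (_ , c<b , _) sub = <⇒≱ c<b (proj₂ (SubNode-bounds sub))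

  ¬SubNode-right-child : ∀ {w : Word σ} {a b c} → IsSplit w a b c → ¬ SubNode w (suc c) b a b
  ¬SubNode-right-child (a≤c , _ , _) sub = <⇒≱ (s≤s a≤c) (proj₁ (SubNode-bounds sub))

  IsSplit-unique : ∀ {w : Word σ} {a b c c'} → b ≤ length w →
                   IsSplit w a b c → IsSplit w a b c' → c ≡ c'
  IsSplit-unique {w} {a} {b} {c} {c'} b≤∣w∣ (a≤c , c<b , min) (a≤c' , c'<b , min') =
    ∸-cancelˡ-≡ (<⇒≤ c<b) (<⇒≤ c'<b) (begin
      b ∸ c                        ≡⟨ length-factor w {suc c} (s≤s z≤n) b≤∣w∣ ⟨
      length (factor w (suc c) b)  ≡⟨ cong length same-suffix ⟩
      length (factor w (suc c') b) ≡⟨ length-factor w {suc c'} (s≤s z≤n) b≤∣w∣ ⟩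
      b ∸ c'                       ∎)
    where
    open ≡-Reasoning
    same-suffix : factor w (suc c) b ≡ factor w (suc c') b
    same-suffix = ⪯-antisym (min (suc c') (s≤s a≤c') c'<b) (min' (suc c) (s≤s a≤c) c<b)

  ¬lyndon-straddling-split : ∀ {w : Word σ} {a b c i j} → IsSplit w a b c →
                             b ≤ length w → a < i → i ≤ c → c < j → j ≤ b →
                             ¬ IsLyndon (factor w i j)
  ¬lyndon-straddling-split {w} (_ , _ , min) b≤∣w∣ a<i i≤c c<j j≤b lyn =
    ≺⇒⋡ (factor-≺-extend w (≤-trans i≤c (n≤1+n _)) j≤b
          (lyndon-factor-≺-suffix w (≤-trans (s≤s z≤n) a<i) (s≤s i≤c) c<j
            (≤-trans j≤b b≤∣w∣) lyn))
        (min _ a<i (≤-trans i≤c (≤-trans (<⇒≤ c<j) j≤b)))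

lemma7 : ∀ {σ} (w : Word σ) → IsLyndon w →
         ∀ i j → 1 ≤ i → i ≤ j → j ≤ length w →
         IsLyndon (factor w i j) →
         ∀ a b → IsLCA w i j a b →
         (a ≡ i) × (i ≤ j) × (j ≤ b)
lemma7 w _ i j _ i≤j _ lyn a b ((node , i-below , j-below) , lowest) =
  starts-at-i i-below j-below , i≤j , proj₂ (SubNode-bounds j-below)
  where
  b≤∣w∣ : b ≤ length w
  b≤∣w∣ = proj₂ (SubNode-bounds node)
  starts-at-i : SubNode w a b i i → SubNode w a b j j → a ≡ i
  starts-at-i here _ = refl
  starts-at-i i-below@(left _ _)  here = ≤-antisym (proj₁ (SubNode-bounds i-below)) i≤j
  starts-at-i i-below@(right _ _) here = ≤-antisym (proj₁ (SubNode-bounds i-below)) i≤j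
  starts-at-i (left {c = c} s pi) (left s' pj) with refl ← IsSplit-unique b≤∣w∣ s s' =
    ⊥-elim (¬SubNode-left-child s (lowest a c (SubNode-trans node (left s here) , pi , pj)))
  starts-at-i (right {c = c} s pi) (right s' pj) with refl ← IsSplit-unique b≤∣w∣ s s' =
    ⊥-elim (¬SubNode-right-child s (lowest (suc c) b (SubNode-trans node (right s here) , pi , pj)))
  starts-at-i (right s pi) (left s' pj) with refl ← IsSplit-unique b≤∣w∣ s s' =
    ⊥-elim (<⇒≱ (≤-trans (proj₁ (SubNode-bounds pi)) i≤j) (proj₂ (SubNode-bounds pj)))
  starts-at-i (left s pi) (right s' pj) with refl ← IsSplit-unique b≤∣w∣ s s'
                                          | m≤n⇒m<n∨m≡n (proj₁ (SubNode-bounds pi))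
  ... | inj₂ a≡i = a≡i
  ... | inj₁ a<i = ⊥-elim (¬lyndon-straddling-split s b≤∣w∣ a<i
                     (proj₂ (SubNode-bounds pi)) (proj₁ (SubNode-bounds pj))
                     (proj₂ (SubNode-bounds pj)) lyn)
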